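{- We have $\sup_A \overline{\mathrm{d}}(A)=1$, where the supremum is over all L-primitive sets $A$.
   Context: For an integer $a>1$ let $P(a)$ be its largest prime factor and $\mathrm{L}_a=\{ba : b\in\mathbb{N},\ \text{every prime } p\mid b \text{ satisfies } p\ge P(a)\}$. A set $A\subset\mathbb{Z}_{>1}$ is L-primitive if $a'\notin\mathrm{L}_a$ for all distinct $a,a'\in A$. The upper density is $\overline{\mathrm{d}}(A)=\limsup_{x\to\infty}|A\cap[1,x]|/x$. -}

module Defs where

open import Data.Nat as ℕ using (ℕ; zero; suc; _≤_; _+_)
open import Data.Nat.Divisibility using (_∣_)
open import Data.Nat.Primality using (Prime)
open import Data.Bool using (Bool; true; false; T; if_then_else_)
open import Data.Integer using (+_)
open import Data.Product using (Σ; ∃; _×_)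
open import Relation.Binary.PropositionalEquality using (_≡_; _≢_)
open import Relation.Nullary using (¬_)
open import Data.Rational as ℚ using (ℚ; 0ℚ; 1ℚ; _/_)

IsLargestPrimeFactor : ℕ → ℕ → Set
IsLargestPrimeFactor a q = Prime q × q ∣ a × (∀ p → Prime p → p ∣ a → p ≤ q)

InL : ℕ → ℕ → Set
InL a a' = Σ ℕ λ b → 1 ≤ b × a' ≡ b ℕ.* a ×
  (∀ p → Prime p → p ∣ b → ∀ q → IsLargestPrimeFactor a q → q ≤ p)

NatSet : Set
NatSet = ℕ → Bool

SubsetGt1 : NatSet → Set
SubsetGt1 A = ∀ n → T (A n) → 2 ≤ n

LPrimitive : NatSet → Set
LPrimitive A = SubsetGt1 A ×
  (∀ a a' → T (A a) → T (A a') → a ≢ a' → ¬ InL a a')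

count : NatSet → ℕ → ℕ
count A zero = 0
count A (suc x) = count A x + (if A (suc x) then 1 else 0)

fromℕ : ℕ → ℚ
fromℕ n = + n / 1

-- upper density d̄(A) ≥ c  (limsup_{x→∞} count A x / x ≥ c):
-- for every δ > 0 and every N there is x ≥ N with count A x ≥ (c - δ)·x
UpperDensityGE : NatSet → ℚ → Set
UpperDensityGE A c = ∀ (δ : ℚ) → 0ℚ ℚ.< δ → ∀ N → Σ ℕ λ x →
  N ≤ x × (c ℚ.- δ) ℚ.* fromℕ x ℚ.≤ fromℕ (count A x)

-- upper density d̄(A) ≤ c :
-- for every δ > 0 there is N such that count A x ≤ (c + δ)·x for all x ≥ N
UpperDensityLE : NatSet → ℚ → Set
UpperDensityLE A c = ∀ (δ : ℚ) → 0ℚ ℚ.< δ → Σ ℕ λ N → ∀ x →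
  N ≤ x → fromℕ (count A x) ℚ.≤ (c ℚ.+ δ) ℚ.* fromℕ x

SupLPrimitiveUpperDensityIsOne : Set
SupLPrimitiveUpperDensityIsOne =
  (∀ A → LPrimitive A → UpperDensityLE A 1ℚ) ×
  (∀ (ε : ℚ) → 0ℚ ℚ.< ε → Σ NatSet λ A → LPrimitive A × UpperDensityGE A (1ℚ ℚ.- ε))

-- Fix m ≥ 1, C = 4m and very sparse blocks (T_i, C·T_i], T_i = 2^(L_i). Let B consist of the
-- block elements with a prime factor above K_i, and let A be B without the L-multiples of
-- smaller elements of B; A is L-primitive by construction.
-- At x = C·T_j, an n ≤ x outside A is either at most T_j, or K_j-smooth (at most
-- (L_j + C + 1)^(K_j) ≤ T_j such n), or n = b·d with d in an earlier block i and all prime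
-- factors of b above K_i; an L-multiple b·d of d inside block j itself would need b ≥ P(d) > K_j > C.
-- Such b are coprime to K_i!, and the integers coprime to K! have density φ(K!)/K! ≤ 1/D when
-- K = 4^D: the sets (s+1)·{b coprime to K!}, s < K, are disjoint, so φ(K!)/K! · Σ_{s<K} 1/(s+1) ≤ 1.
-- With D_i = 2^(i+1)·8m(C+1) the earlier blocks contribute at most x/(4m), so A has at least
-- (1 - 1/m)·x elements up to x, and 1/m ≤ ε when m is the denominator of ε.

module Submission where

open import Data.Bool using (Bool; true; false; T; not; _∨_; _∧_; if_then_else_)
open import Data.Bool.Properties using (T-∨; T-∧)
open import Data.Empty using (⊥; ⊥-elim)
import Data.Integer as ℤ
import Data.Integer.Properties as ℤ
open import Data.List.Extrema.Nat using (max; argmax-sel; xs≤max)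
open import Data.List.Membership.Propositional using (_∈_)
open import Data.List.Relation.Unary.All as All using (All; []; _∷_)
open import Data.Nat
open import Data.Nat.Coprimality as Coprimality using (Coprime; coprime?; coprime-divisor)
open import Data.Nat.DivMod
open import Data.Nat.Divisibility
open import Data.Nat.Induction using (<-rec)
open import Data.Nat.ListAction using (product)
open import Data.Nat.ListAction.Properties using (∈⇒∣product)
open import Data.Nat.Primality
open import Data.Nat.Primality.Factorisation using (PrimeFactorisation; factorise; factorisationHasAllPrimeFactors)
open import Data.Nat.Properties
open import Algebra.Properties.CommutativeSemigroup +-commutativeSemigroup using (interchange)
open import Data.Nat.Tactic.RingSolver using (solve-∀)
open import Data.Product using (Σ; ∃; ∃₂; _×_; _,_; proj₁; proj₂)
import Data.Rational as ℚ
import Data.Rational.Properties as ℚ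
open import Data.Rational.Solver using (module +-*-Solver)
import Data.Rational.Unnormalised as ℚᵘ
import Data.Rational.Unnormalised.Properties as ℚᵘ
open import Data.Sum using (inj₁; inj₂)
open import Data.Unit using (tt)
open import Defs
open import Function using (_∘_; id; Equivalence)
open import Relation.Binary.Definitions using (tri<; tri≈; tri>)
open import Relation.Binary.PropositionalEquality
open import Relation.Nullary using (¬_; Dec; yes; no)
open import Relation.Nullary.Decidable using (⌊_⌋; _×-dec_; _→-dec_; T?; toWitness; fromWitness)

-- Counting

𝟙 : Bool → ℕ
𝟙 b = if b then 1 else 0

_∪_ : NatSet → NatSet → NatSet
(A ∪ B) n = A n ∨ B n

∁ : NatSet → NatSet
∁ A n = not (A n)

∁-∉ : ∀ {A n} → T (∁ A n) → ¬ T (A n)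
∁-∉ {A} {n} with A n
... | true  = λ ()
... | false = λ _ ()

⋃< : ℕ → (ℕ → NatSet) → NatSet
⋃< zero    F n = false
⋃< (suc K) F   = ⋃< K F ∪ F K

sum< : ℕ → (ℕ → ℕ) → ℕ
sum< zero    f = 0
sum< (suc K) f = sum< K f + f K

atMost : ℕ → NatSet
atMost t n = ⌊ n ≤? t ⌋

multiples : (d : ℕ) → .{{NonZero d}} → NatSet → NatSet
multiples d S n = ⌊ d ∣? n ⌋ ∧ S (n / d)

count-pointwise-≤ : ∀ {A B C} x → (∀ n → 𝟙 (C n) ≤ 𝟙 (A n) + 𝟙 (B n)) →
                    count C x ≤ count A x + count B x
count-pointwise-≤ zero    _ = z≤n
count-pointwise-≤ {A} {B} {C} (suc x) le = begin
  count C x + 𝟙 (C (suc x))                      ≤⟨ +-mono-≤ (count-pointwise-≤ x le) (le (suc x)) ⟩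
  (count A x + count B x) + (𝟙 (A _) + 𝟙 (B _))  ≡⟨ interchange (count A x) _ _ _ ⟩
  (count A x + 𝟙 (A _)) + (count B x + 𝟙 (B _))  ∎
  where open ≤-Reasoning

count-pointwise-≡ : ∀ {A B C} x → (∀ n → 𝟙 (C n) ≡ 𝟙 (A n) + 𝟙 (B n)) →
                    count C x ≡ count A x + count B x
count-pointwise-≡ zero    _ = refl
count-pointwise-≡ {A} {B} {C} (suc x) eq = begin
  count C x + 𝟙 (C (suc x))                      ≡⟨ cong₂ _+_ (count-pointwise-≡ x eq) (eq (suc x)) ⟩
  (count A x + count B x) + (𝟙 (A _) + 𝟙 (B _))  ≡⟨ interchange (count A x) _ _ _ ⟩
  (count A x + 𝟙 (A _)) + (count B x + 𝟙 (B _))  ∎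
  where open ≡-Reasoning

count≤ : ∀ A x → count A x ≤ x
count≤ A zero    = z≤n
count≤ A (suc x) = ≤-trans (+-mono-≤ (count≤ A x) (𝟙≤1 (A (suc x)))) (≤-reflexive (+-comm x 1))
  where
  𝟙≤1 : ∀ b → 𝟙 b ≤ 1
  𝟙≤1 true  = ≤-refl
  𝟙≤1 false = z≤n

count-mono : ∀ {A B} x → (∀ n → 1 ≤ n → n ≤ x → T (A n) → T (B n)) → count A x ≤ count B x
count-mono zero    _   = z≤n
count-mono {A} {B} (suc x) A⊆B =
  +-mono-≤ (count-mono x (λ n 1≤n n≤x → A⊆B n 1≤n (m≤n⇒m≤1+n n≤x)))
           (𝟙-mono (A (suc x)) (B (suc x)) (A⊆B (suc x) (s≤s z≤n) ≤-refl))
  where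
  𝟙-mono : ∀ a b → (T a → T b) → 𝟙 a ≤ 𝟙 b
  𝟙-mono true  true  _ = ≤-refl
  𝟙-mono true  false f = ⊥-elim (f tt)
  𝟙-mono false _     _ = z≤n

count-monoʳ : ∀ A {x y} → x ≤ y → count A x ≤ count A y
count-monoʳ A {y = zero}  z≤n = z≤n
count-monoʳ A {y = suc y} x≤1+y with m≤n⇒m<n∨m≡n x≤1+y
... | inj₂ refl       = ≤-refl
... | inj₁ (s≤s x≤y) = ≤-trans (count-monoʳ A x≤y) (m≤m+n (count A y) _)

count-∪ : ∀ A B x → count (A ∪ B) x ≤ count A x + count B x
count-∪ A B x = count-pointwise-≤ x (λ n → 𝟙-∨ (A n) (B n))
  where
  𝟙-∨ : ∀ a b → 𝟙 (a ∨ b) ≤ 𝟙 a + 𝟙 b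
  𝟙-∨ true  _ = s≤s z≤n
  𝟙-∨ false _ = ≤-refl

count-∪-disjoint : ∀ A B x → (∀ n → T (A n) → ¬ T (B n)) → count (A ∪ B) x ≡ count A x + count B x
count-∪-disjoint A B x disj = count-pointwise-≡ x (λ n → 𝟙-∨ (A n) (B n) (disj n))
  where
  𝟙-∨ : ∀ a b → (T a → ¬ T b) → 𝟙 (a ∨ b) ≡ 𝟙 a + 𝟙 b
  𝟙-∨ true  true  d = ⊥-elim (d tt tt)
  𝟙-∨ true  false _ = refl
  𝟙-∨ false _     _ = refl

count-∁ : ∀ A x → count A x + count (∁ A) x ≡ x
count-∁ A x = trans (sym (count-pointwise-≡ x (λ n → 𝟙-not (A n)))) (count-all x)
  where
  𝟙-not : ∀ a → 𝟙 true ≡ 𝟙 a + 𝟙 (not a)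
  𝟙-not true  = refl
  𝟙-not false = refl
  count-all : ∀ x → count (λ _ → true) x ≡ x
  count-all zero    = refl
  count-all (suc x) = trans (cong (_+ 1) (count-all x)) (+-comm x 1)

∈-⋃< : ∀ K F {k n} → k < K → T (F k n) → T (⋃< K F n)
∈-⋃< (suc K) F {k} {n} k<1+K n∈Fk with m<1+n⇒m<n∨m≡n k<1+K
... | inj₁ k<K = Equivalence.from T-∨ (inj₁ (∈-⋃< K F k<K n∈Fk))
... | inj₂ refl = Equivalence.from T-∨ (inj₂ n∈Fk)

∈-⋃<⁻ : ∀ K F {n} → T (⋃< K F n) → ∃ λ k → k < K × T (F k n)
∈-⋃<⁻ (suc K) F {n} n∈⋃ with Equivalence.to T-∨ n∈⋃
... | inj₁ n∈⋃K with ∈-⋃<⁻ K F n∈⋃K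
...   | k , k<K , n∈Fk = k , m<n⇒m<1+n k<K , n∈Fk
∈-⋃<⁻ (suc K) F {n} n∈⋃ | inj₂ n∈FK = K , ≤-refl , n∈FK

count-⋃<-zero : ∀ F x → count (⋃< zero F) x ≡ 0
count-⋃<-zero F zero    = refl
count-⋃<-zero F (suc x) = cong (_+ 0) (count-⋃<-zero F x)

count-⋃< : ∀ K F x → count (⋃< K F) x ≤ sum< K (λ k → count (F k) x)
count-⋃< zero    F x = ≤-reflexive (count-⋃<-zero F x)
count-⋃< (suc K) F x = ≤-trans (count-∪ (⋃< K F) (F K) x) (+-monoˡ-≤ _ (count-⋃< K F x))

count-⋃<-disjoint : ∀ K F x → (∀ {k k' n} → k < K → k' < K → T (F k n) → T (F k' n) → k ≡ k') →
                    count (⋃< K F) x ≡ sum< K (λ k → count (F k) x)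
count-⋃<-disjoint zero    F x _    = count-⋃<-zero F x
count-⋃<-disjoint (suc K) F x uniq =
  trans (count-∪-disjoint (⋃< K F) (F K) x disjoint)
        (cong (_+ count (F K) x) (count-⋃<-disjoint K F x (λ k<K k'<K → uniq (m<n⇒m<1+n k<K) (m<n⇒m<1+n k'<K))))
  where
  disjoint : ∀ n → T (⋃< K F n) → ¬ T (F K n)
  disjoint n n∈⋃ n∈FK with ∈-⋃<⁻ K F n∈⋃
  ... | k , k<K , n∈Fk = <-irrefl (uniq (m<n⇒m<1+n k<K) ≤-refl n∈Fk n∈FK) k<K

count-atMost : ∀ t x → count (atMost t) x ≤ t
count-atMost t zero    = z≤n
count-atMost t (suc x) with suc x ≤? t
... | yes 1+x≤t = ≤-trans (≤-reflexive (+-comm _ 1)) (≤-trans (s≤s (count≤ _ x)) 1+x≤t)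
... | no  _     = ≤-trans (≤-reflexive (+-identityʳ _)) (count-atMost t x)

sum<-mono : ∀ {f g} K → (∀ k → k < K → f k ≤ g k) → sum< K f ≤ sum< K g
sum<-mono zero    _   = z≤n
sum<-mono (suc K) f≤g = +-mono-≤ (sum<-mono K (λ k k<K → f≤g k (m<n⇒m<1+n k<K))) (f≤g K ≤-refl)

sum<-cong : ∀ {f g} K → (∀ k → k < K → f k ≡ g k) → sum< K f ≡ sum< K g
sum<-cong zero    _   = refl
sum<-cong (suc K) f≡g = cong₂ _+_ (sum<-cong K (λ k k<K → f≡g k (m<n⇒m<1+n k<K))) (f≡g K ≤-refl)

sum<-const : ∀ K c → sum< K (λ _ → c) ≡ K * c
sum<-const zero    c = refl
sum<-const (suc K) c = trans (cong (_+ c) (sum<-const K c)) (+-comm (K * c) c)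

*-distribˡ-sum< : ∀ c K f → c * sum< K f ≡ sum< K (λ k → c * f k)
*-distribˡ-sum< c zero    f = *-zeroʳ c
*-distribˡ-sum< c (suc K) f = trans (*-distribˡ-+ c (sum< K f) (f K)) (cong (_+ c * f K) (*-distribˡ-sum< c K f))

sum<-+ : ∀ K L f → sum< (K + L) f ≡ sum< K f + sum< L (λ k → f (K + k))
sum<-+ K zero    f = trans (cong (λ n → sum< n f) (+-identityʳ K)) (sym (+-identityʳ _))
sum<-+ K (suc L) f = trans (cong (λ n → sum< n f) (+-suc K L))
                           (trans (cong (_+ f (K + L)) (sum<-+ K L f)) (+-assoc (sum< K f) _ _))

sum<-halving : ∀ j a Y → (∀ i → i < j → 2 ^ suc i * a i ≤ Y) → sum< j a ≤ Y
sum<-halving j a Y bound = *-cancelˡ-≤ (2 ^ j) {{m^n≢0 2 j}} (≤-trans (m≤m+n _ Y) (weighted j bound))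
  where
  weighted : ∀ j → (∀ i → i < j → 2 ^ suc i * a i ≤ Y) → 2 ^ j * sum< j a + Y ≤ 2 ^ j * Y
  weighted zero    _     = ≤-reflexive (sym (+-identityʳ Y))
  weighted (suc j) bound = begin
    2 * t * (S + a j) + Y       ≡⟨ expand t S (a j) Y ⟩
    2 * (t * S) + 2 * t * a j + Y ≤⟨ +-monoˡ-≤ Y (+-monoʳ-≤ (2 * (t * S)) (bound j ≤-refl)) ⟩
    2 * (t * S) + Y + Y         ≡⟨ collect (t * S) Y ⟩
    2 * (t * S + Y)             ≤⟨ *-monoʳ-≤ 2 (weighted j (λ i i<j → bound i (m<n⇒m<1+n i<j))) ⟩
    2 * (t * Y)                 ≡⟨ sym (*-assoc 2 t Y) ⟩
    2 * t * Y                   ∎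
    where
    open ≤-Reasoning
    t = 2 ^ j
    S = sum< j a
    expand : ∀ t S b Y → 2 * t * (S + b) + Y ≡ 2 * (t * S) + 2 * t * b + Y
    expand = solve-∀
    collect : ∀ s Y → 2 * s + Y + Y ≡ 2 * (s + Y)
    collect = solve-∀

multiples-multiple : ∀ d .{{_ : NonZero d}} S b → multiples d S (b * d) ≡ S b
multiples-multiple d S b with d ∣? b * d
... | yes _   = cong S (m*n/n≡m b d)
... | no  d∤ = ⊥-elim (d∤ (n∣m*n b))

multiples-non-multiple : ∀ d .{{_ : NonZero d}} S k r → 0 < r → r < d → multiples d S (k * d + r) ≡ false
multiples-non-multiple d S k r 0<r r<d with d ∣? k * d + r
... | no  _   = refl
... | yes d∣ = ⊥-elim (<⇒≱ r<d (∣⇒≤ {{>-nonZero 0<r}} (∣m+n∣m⇒∣n d∣ (n∣m*n k))))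

count-multiples : ∀ d .{{_ : NonZero d}} S k r → r < d → count (multiples d S) (k * d + r) ≡ count S k
count-multiples d S zero    zero    _   = refl
count-multiples d@(suc e) S (suc k) zero    _   = begin
  count M (suc k * d + 0)                        ≡⟨ cong (count M) k*d+d≡ ⟩
  count M (k * d + e) + 𝟙 (M (suc (k * d + e)))  ≡⟨ cong₂ _+_ (count-multiples d S k e ≤-refl)
                                                          (cong (𝟙 ∘ M) (sym k*d+d≡)) ⟩
  count S k + 𝟙 (M (suc k * d + 0))              ≡⟨ cong (λ t → count S k + 𝟙 t)
                                                          (trans (cong M (+-identityʳ _)) (multiples-multiple d S (suc k))) ⟩
  count S (suc k)                                ∎
  where
  open ≡-Reasoning
  M = multiples d S
  k*d+d≡ : suc k * d + 0 ≡ suc (k * d + e)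
  k*d+d≡ = trans (+-identityʳ _) (trans (+-comm d (k * d)) (+-suc (k * d) e))
count-multiples d S k (suc r) 1+r<d = begin
  count M (k * d + suc r)                      ≡⟨ cong (count M) (+-suc (k * d) r) ⟩
  count M (k * d + r) + 𝟙 (M (suc (k * d + r))) ≡⟨ cong₂ _+_ (count-multiples d S k r (<-trans (n<1+n r) 1+r<d))
                                                        (cong (𝟙 ∘ M) (sym (+-suc (k * d) r))) ⟩
  count S k + 𝟙 (M (k * d + suc r))            ≡⟨ cong (λ t → count S k + 𝟙 t)
                                                        (multiples-non-multiple d S k (suc r) z<s 1+r<d) ⟩
  count S k + 0                                ≡⟨ +-identityʳ _ ⟩
  count S k                                    ∎
  where
  open ≡-Reasoning
  M = multiples d S

count-multiples-≤ : ∀ d .{{_ : NonZero d}} S k x → x < suc k * d → count (multiples d S) x ≤ count S k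
count-multiples-≤ d@(suc e) S k x x<[1+k]d = begin
  count (multiples d S) x            ≤⟨ count-monoʳ (multiples d S) x≤k*d+e ⟩
  count (multiples d S) (k * d + e)  ≡⟨ count-multiples d S k e ≤-refl ⟩
  count S k                          ∎
  where
  open ≤-Reasoning
  x≤k*d+e : x ≤ k * d + e
  x≤k*d+e = m<1+n⇒m≤n (subst (x <_) (trans (+-comm d (k * d)) (+-suc (k * d) e)) x<[1+k]d)

∈-multiples : ∀ d .{{_ : NonZero d}} S {b} → T (S b) → T (multiples d S (b * d))
∈-multiples d S {b} b∈S = subst T (sym (multiples-multiple d S b)) b∈S

count-multiples-≤-count : ∀ d .{{_ : NonZero d}} S x → count (multiples d S) x ≤ count S x
count-multiples-≤-count d S x = count-multiples-≤ d S x x (m≤m*n (suc x) d)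

module _ {A : NatSet} {p : ℕ} (periodic : ∀ n → A (p + n) ≡ A n) where

  count-shift : ∀ y → count A (p + y) ≡ count A p + count A y
  count-shift zero    = trans (cong (count A) (+-identityʳ p)) (sym (+-identityʳ _))
  count-shift (suc y) = begin
    count A (p + suc y)                        ≡⟨ cong (count A) (+-suc p y) ⟩
    count A (p + y) + 𝟙 (A (suc (p + y)))      ≡⟨ cong₂ _+_ (count-shift y)
                                                   (cong 𝟙 (trans (cong A (sym (+-suc p y))) (periodic (suc y)))) ⟩
    count A p + count A y + 𝟙 (A (suc y))      ≡⟨ +-assoc (count A p) _ _ ⟩
    count A p + count A (suc y)                ∎
    where open ≡-Reasoning

  count-periodic : ∀ q r → count A (q * p + r) ≡ q * count A p + count A r
  count-periodic zero    r = refl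
  count-periodic (suc q) r = begin
    count A (p + q * p + r)                ≡⟨ cong (count A) (+-assoc p (q * p) r) ⟩
    count A (p + (q * p + r))              ≡⟨ count-shift (q * p + r) ⟩
    count A p + count A (q * p + r)        ≡⟨ cong (count A p +_) (count-periodic q r) ⟩
    count A p + (q * count A p + count A r) ≡⟨ sym (+-assoc (count A p) _ _) ⟩
    suc q * count A p + count A r          ∎
    where open ≡-Reasoning

-- Prime factors

prime≥2 : ∀ {p} → Prime p → 2 ≤ p
prime≥2 {p} p-prime = nonTrivial⇒n>1 p {{prime⇒nonTrivial p-prime}}

largestPrimeFactor : ∀ a → 2 ≤ a → ∃ (IsLargestPrimeFactor a)
largestPrimeFactor a 2≤a = max 0 factors , All.lookup factorsPrime max∈factors , divides-a max∈factors , ≤max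
  where
  instance
    a≢0 : NonZero a
    a≢0 = >-nonZero (<-trans z<s 2≤a)
  open PrimeFactorisation (factorise a)

  divides-a : ∀ {p} → p ∈ factors → p ∣ a
  divides-a p∈ = subst (_ ∣_) (sym isFactorisation) (∈⇒∣product p∈)

  ≤max : ∀ p → Prime p → p ∣ a → p ≤ max 0 factors
  ≤max p p-prime p∣a = All.lookup (xs≤max 0 factors)
    (factorisationHasAllPrimeFactors p-prime (subst (p ∣_) isFactorisation p∣a) factorsPrime)

  no-prime≤0 : ∀ {qs} → All Prime qs → All (_≤ 0) qs → a ≢ product qs
  no-prime≤0 []              []         a≡1 = <⇒≢ 2≤a (sym a≡1)
  no-prime≤0 (q-prime ∷ _) (q≤0 ∷ _) _   = <⇒≱ (prime≥2 q-prime) (≤-trans q≤0 z≤n)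

  max∈factors : max 0 factors ∈ factors
  max∈factors with argmax-sel id 0 factors
  ... | inj₂ max∈ = max∈
  ... | inj₁ max≡0 = ⊥-elim (no-prime≤0 factorsPrime (subst (λ m → All (_≤ m) factors) max≡0 (xs≤max 0 factors))
                                         isFactorisation)

primeFactor : ∀ n → 2 ≤ n → ∃ λ p → Prime p × p ∣ n
primeFactor n 2≤n with largestPrimeFactor n 2≤n
... | p , p-prime , p∣n , _ = p , p-prime , p∣n

prime∣!⇒≤ : ∀ {p} K → Prime p → p ∣ K ! → p ≤ K
prime∣!⇒≤ zero    p-prime p∣1 = ⊥-elim (<⇒≱ (prime≥2 p-prime) (∣⇒≤ p∣1))
prime∣!⇒≤ (suc K) p-prime p∣K! with euclidsLemma (suc K) (K !) p-prime p∣K!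
... | inj₁ p∣1+K = ∣⇒≤ p∣1+K
... | inj₂ p∣K!  = m≤n⇒m≤1+n (prime∣!⇒≤ K p-prime p∣K!)

coprime-factorial : ∀ b K → (∀ p → Prime p → p ∣ b → K < p) → Coprime b (K !)
coprime-factorial b K rough {zero}          (_ , 0∣K!) = ⊥-elim (≢-nonZero⁻¹ (K !) {{K !≢0}} (0∣⇒≡0 0∣K!))
coprime-factorial b K rough {suc zero}      _          = refl
coprime-factorial b K rough {d@(suc (suc _))} (d∣b , d∣K!) with primeFactor d (s≤s (s≤s z≤n))
... | p , p-prime , p∣d =
  ⊥-elim (<⇒≱ (rough p p-prime (∣-trans p∣d d∣b)) (prime∣!⇒≤ K p-prime (∣-trans p∣d d∣K!)))

-- Smooth numbers

Smooth : ℕ → ℕ → Set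
Smooth K n = ∀ p → Prime p → p ∣ n → p ≤ K

-- The bound p ≤ n makes this decidable and loses nothing for n ≥ 1.
HasPrimeFactorAbove : ℕ → ℕ → Set
HasPrimeFactorAbove K n = ∃ λ p → p < suc n × Prime p × p ∣ n × K < p

hasPrimeFactorAbove? : ∀ K n → Dec (HasPrimeFactorAbove K n)
hasPrimeFactorAbove? K n = anyUpTo? (λ p → prime? p ×-dec p ∣? n ×-dec K <? p) (suc n)

smooth : ℕ → NatSet
smooth K n = not ⌊ hasPrimeFactorAbove? K n ⌋

smooth⇒Smooth : ∀ {K n} → 1 ≤ n → T (smooth K n) → Smooth K n
smooth⇒Smooth {K} {n} 1≤n n∈smooth p p-prime p∣n with hasPrimeFactorAbove? K n
... | no ¬above = ≮⇒≥ (λ K<p → ¬above (p , s≤s (∣⇒≤ {{>-nonZero 1≤n}} p∣n) , p-prime , p∣n , K<p))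

Smooth⇒smooth : ∀ {K n} → Smooth K n → T (smooth K n)
Smooth⇒smooth {K} {n} n-smooth with hasPrimeFactorAbove? K n
... | yes (p , _ , p-prime , p∣n , K<p) = <⇒≱ K<p (n-smooth p p-prime p∣n)
... | no _                              = tt

¬smooth⇒HasPrimeFactorAbove : ∀ {K n} → ¬ T (smooth K n) → HasPrimeFactorAbove K n
¬smooth⇒HasPrimeFactorAbove {K} {n} n∉smooth with hasPrimeFactorAbove? K n
... | yes above = above
... | no _      = ⊥-elim (n∉smooth tt)

Smooth-∣ : ∀ {K m n} → m ∣ n → Smooth K n → Smooth K m
Smooth-∣ m∣n n-smooth p p-prime p∣m = n-smooth p p-prime (∣-trans p∣m m∣n)

Smooth[1]⇒≡1 : ∀ {n} → 1 ≤ n → Smooth 1 n → n ≡ 1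
Smooth[1]⇒≡1 {suc zero}    _ _        = refl
Smooth[1]⇒≡1 {suc (suc n)} _ n-smooth with primeFactor (2 + n) (s≤s (s≤s z≤n))
... | p , p-prime , p∣n = ⊥-elim (<⇒≱ (prime≥2 p-prime) (n-smooth p p-prime p∣n))

smooth-decompose : ∀ K n → 1 ≤ n → Smooth (2 + K) n →
                   ∃₂ λ e n' → n ≡ (2 + K) ^ e * n' × Smooth (suc K) n'
smooth-decompose K = <-rec _ decompose
  where
  b = 2 + K
  decompose : ∀ n → (∀ {m} → m < n → 1 ≤ m → Smooth b m → ∃₂ λ e m' → m ≡ b ^ e * m' × Smooth (suc K) m') →
              1 ≤ n → Smooth b n → ∃₂ λ e n' → n ≡ b ^ e * n' × Smooth (suc K) n'
  decompose n rec 1≤n n-smooth with b ∣? n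
  ... | no b∤n = 0 , n , sym (+-identityʳ n) , n-smooth'
    where
    n-smooth' : Smooth (suc K) n
    n-smooth' p p-prime p∣n with m≤n⇒m<n∨m≡n (n-smooth p p-prime p∣n)
    ... | inj₁ p<b = m<1+n⇒m≤n p<b
    ... | inj₂ refl = ⊥-elim (b∤n p∣n)
  ... | yes (divides zero refl) = ⊥-elim (<⇒≱ 1≤n z≤n)
  ... | yes (divides m@(suc _) refl) with rec (m<m*n m b (s≤s (s≤s z≤n))) (s≤s z≤n) (Smooth-∣ (divides b (*-comm m b)) n-smooth)
  ...   | e , m' , m≡ , m'-smooth = suc e , m' , n≡ , m'-smooth
    where
    n≡ : m * b ≡ b ^ suc e * m'
    n≡ = trans (cong (_* b) m≡) (trans (*-comm (b ^ e * m') b) (sym (*-assoc b (b ^ e) m')))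

count-smooth≤1 : ∀ {K} x → K ≤ 1 → count (smooth K) x ≤ 1
count-smooth≤1 {K} x K≤1 = ≤-trans (count-mono x ⊆one) (count-one x)
  where
  ⊆one : ∀ n → 1 ≤ n → n ≤ x → T (smooth K n) → T ⌊ n ≟ 1 ⌋
  ⊆one n 1≤n _ n∈smooth =
    fromWitness (Smooth[1]⇒≡1 1≤n (λ p p-prime p∣n → ≤-trans (smooth⇒Smooth 1≤n n∈smooth p p-prime p∣n) K≤1))
  count-one : ∀ x → count (λ n → ⌊ n ≟ 1 ⌋) x ≤ 1
  count-one zero          = z≤n
  count-one (suc zero)    = ≤-refl
  count-one (suc (suc x)) = ≤-trans (≤-reflexive (+-identityʳ _)) (count-one (suc x))

count-smooth : ∀ K L x → x ≤ 2 ^ L → count (smooth K) x ≤ suc L ^ K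
count-smooth zero          L x _ = count-smooth≤1 x z≤n
count-smooth (suc zero)    L x _ = ≤-trans (count-smooth≤1 x ≤-refl) (m^n>0 (suc L) 1)
count-smooth (suc (suc K)) L x x≤2^L = begin
  count (smooth (2 + K)) x               ≤⟨ count-mono x smooth⊆⋃ ⟩
  count (⋃< (suc L) F) x                 ≤⟨ count-⋃< (suc L) F x ⟩
  sum< (suc L) (λ e → count (F e) x)     ≤⟨ sum<-mono (suc L) (λ e _ →
                                              ≤-trans (count-multiples-≤-count _ {{m^n≢0 (2 + K) e}} _ x)
                                                      (count-smooth (suc K) L x x≤2^L)) ⟩
  sum< (suc L) (λ _ → suc L ^ suc K)     ≡⟨ sum<-const (suc L) _ ⟩
  suc L ^ suc (suc K)                    ∎
  where
  open ≤-Reasoning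
  F : ℕ → NatSet
  F e = multiples ((2 + K) ^ e) {{m^n≢0 (2 + K) e}} (smooth (suc K))

  smooth⊆⋃ : ∀ n → 1 ≤ n → n ≤ x → T (smooth (2 + K) n) → T (⋃< (suc L) F n)
  smooth⊆⋃ n 1≤n n≤x n∈smooth with smooth-decompose K n 1≤n (smooth⇒Smooth 1≤n n∈smooth)
  ... | e , zero , n≡ , _ = ⊥-elim (<⇒≱ 1≤n (≤-reflexive (trans n≡ (*-zeroʳ ((2 + K) ^ e)))))
  ... | e , n'@(suc _) , n≡ , n'-smooth = ∈-⋃< (suc L) F e≤L n∈Fe
    where
    n∈Fe : T (F e n)
    n∈Fe = subst (T ∘ F e) (sym (trans n≡ (*-comm ((2 + K) ^ e) n')))
             (∈-multiples ((2 + K) ^ e) {{m^n≢0 (2 + K) e}} (smooth (suc K)) (Smooth⇒smooth n'-smooth))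
    2^e≤2^L : 2 ^ e ≤ 2 ^ L
    2^e≤2^L = begin
      2 ^ e            ≤⟨ ^-monoˡ-≤ e (s≤s (s≤s z≤n)) ⟩
      (2 + K) ^ e      ≤⟨ m≤m*n _ n' ⟩
      (2 + K) ^ e * n' ≡⟨ sym n≡ ⟩
      n                ≤⟨ ≤-trans n≤x x≤2^L ⟩
      2 ^ L            ∎
    e≤L : e < suc L
    e≤L = s≤s (≮⇒≥ (λ L<e → <⇒≱ (^-monoʳ-< 2 (s≤s (s≤s z≤n)) L<e) 2^e≤2^L))

-- Integers coprime to K!

coprimeTo : ℕ → NatSet
coprimeTo P n = ⌊ coprime? n P ⌋

coprimeTo-periodic : ∀ P n → coprimeTo P (P + n) ≡ coprimeTo P n
coprimeTo-periodic P n with coprime? (P + n) P | coprime? n P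
... | yes _  | yes _  = refl
... | no _   | no _   = refl
... | yes c  | no ¬c  = ⊥-elim (¬c (λ (d∣n , d∣P) → c (∣m∣n⇒∣m+n d∣P d∣n , d∣P)))
... | no ¬c  | yes c  = ⊥-elim (¬c (λ (d∣P+n , d∣P) → c (∣m+n∣m⇒∣n d∣P+n d∣P , d∣P)))

φ : ℕ → ℕ
φ P = count (coprimeTo P) P

count-coprimeTo : ∀ P q → count (coprimeTo P) (q * P) ≡ q * φ P
count-coprimeTo P q = begin
  count (coprimeTo P) (q * P)      ≡⟨ cong (count (coprimeTo P)) (sym (+-identityʳ (q * P))) ⟩
  count (coprimeTo P) (q * P + 0)  ≡⟨ count-periodic (coprimeTo-periodic P) q 0 ⟩
  q * φ P + 0                      ≡⟨ +-identityʳ _ ⟩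
  q * φ P                          ∎
  where open ≡-Reasoning

harmonic-lower-bound : ∀ P a f → (∀ s → s < 2 ^ a → P ≤ suc s * f s) → a * P ≤ 2 * sum< (2 ^ a) f
harmonic-lower-bound P zero    f _     = z≤n
harmonic-lower-bound P (suc a) f bound = begin
  suc a * P                                  ≡⟨ +-comm P (a * P) ⟩
  a * P + P                                  ≤⟨ +-mono-≤ (harmonic-lower-bound P a f (λ s s< → bound s (<-≤-trans s< 2^a≤2^[1+a])))
                                                         upper-half ⟩
  2 * sum< t f + 2 * sum< t (λ s → f (t + s)) ≡⟨ sym (*-distribˡ-+ 2 (sum< t f) _) ⟩
  2 * (sum< t f + sum< t (λ s → f (t + s)))  ≡⟨ cong (2 *_) (sym (sum<-+ t t f)) ⟩
  2 * sum< (t + t) f                         ≡⟨ cong (λ n → 2 * sum< n f) t+t≡2^[1+a] ⟩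
  2 * sum< (2 ^ suc a) f                     ∎
  where
  open ≤-Reasoning
  t = 2 ^ a
  t+t≡2^[1+a] : t + t ≡ 2 ^ suc a
  t+t≡2^[1+a] = cong (t +_) (sym (+-identityʳ t))
  2^a≤2^[1+a] : t ≤ 2 ^ suc a
  2^a≤2^[1+a] = ≤-trans (m≤m+n t t) (≤-reflexive t+t≡2^[1+a])
  term : ∀ s → s < t → P ≤ 2 ^ suc a * f (t + s)
  term s s<t = ≤-trans (bound (t + s) t+s<) (*-monoˡ-≤ (f (t + s)) t+s<)
    where
    t+s< : t + s < 2 ^ suc a
    t+s< = <-≤-trans (+-monoʳ-< t s<t) (≤-reflexive t+t≡2^[1+a])
  upper-half : P ≤ 2 * sum< t (λ s → f (t + s))
  upper-half = *-cancelˡ-≤ t {{m^n≢0 2 a}} (begin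
    t * P                                   ≡⟨ sym (sum<-const t P) ⟩
    sum< t (λ _ → P)                        ≤⟨ sum<-mono t term ⟩
    sum< t (λ s → 2 ^ suc a * f (t + s))    ≡⟨ sym (*-distribˡ-sum< (2 ^ suc a) t _) ⟩
    2 ^ suc a * sum< t (λ s → f (t + s))    ≡⟨ *-assoc 2 t _ ⟩
    2 * (t * sum< t (λ s → f (t + s)))      ≡⟨ x*[y*z]≡y*[x*z] 2 t _ ⟩
    t * (2 * sum< t (λ s → f (t + s)))      ∎)
    where
    x*[y*z]≡y*[x*z] : ∀ x y z → x * (y * z) ≡ y * (x * z)
    x*[y*z]≡y*[x*z] = solve-∀

module Factorial (K : ℕ) where

  P : ℕ
  P = K !

  instance
    P≢0 : NonZero P
    P≢0 = K !≢0

  1+s∣P : ∀ {s} → s < K → suc s ∣ P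
  1+s∣P {s} s<K = ∣-trans (m∣m*n (s !)) (m≤n⇒m!∣n! s<K)

  coprimeMultiples : ℕ → NatSet
  coprimeMultiples s = multiples (suc s) (coprimeTo P)

  coprimeMultiples-disjoint : ∀ {s s' n} → s < K → s' < K →
                              T (coprimeMultiples s n) → T (coprimeMultiples s' n) → s ≡ s'
  coprimeMultiples-disjoint {s} {s'} {n} s<K s'<K n∈Ms n∈Ms' =
    suc-injective (∣-antisym (1+s∣1+s' s<K n∈Ms n∈Ms') (1+s∣1+s' s'<K n∈Ms' n∈Ms))
    where
    1+s∣1+s' : ∀ {s s'} → s < K → T (coprimeMultiples s n) → T (coprimeMultiples s' n) → suc s ∣ suc s'
    1+s∣1+s' {s} {s'} s<K n∈Ms n∈Ms' with suc s ∣? n | suc s' ∣? n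
    ... | yes 1+s∣n | yes 1+s'∣n = coprime-divisor 1+s⊥b' (subst (suc s ∣_) (sym (m/n*n≡m 1+s'∣n)) 1+s∣n)
      where
      1+s⊥b' : Coprime (suc s) (n / suc s')
      1+s⊥b' (d∣1+s , d∣b') = toWitness n∈Ms' (d∣b' , ∣-trans d∣1+s (1+s∣P s<K))

  count-coprimeMultiples : ∀ {s} → s < K → count (coprimeMultiples s) (P * P) ≡ P / suc s * φ P
  count-coprimeMultiples {s} s<K = begin
    count (coprimeMultiples s) (P * P)                     ≡⟨ cong (count (coprimeMultiples s)) P*P≡ ⟩
    count (coprimeMultiples s) (P / suc s * P * suc s + 0) ≡⟨ count-multiples (suc s) (coprimeTo P) (P / suc s * P) 0 z<s ⟩
    count (coprimeTo P) (P / suc s * P)                    ≡⟨ count-coprimeTo P (P / suc s) ⟩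
    P / suc s * φ P                                        ∎
    where
    open ≡-Reasoning
    P*P≡ : P * P ≡ P / suc s * P * suc s + 0
    P*P≡ = sym (begin
      P / suc s * P * suc s + 0     ≡⟨ +-identityʳ _ ⟩
      P / suc s * P * suc s         ≡⟨ *-assoc (P / suc s) P (suc s) ⟩
      P / suc s * (P * suc s)       ≡⟨ cong (P / suc s *_) (*-comm P (suc s)) ⟩
      P / suc s * (suc s * P)       ≡⟨ sym (*-assoc (P / suc s) (suc s) P) ⟩
      P / suc s * suc s * P         ≡⟨ cong (_* P) (m/n*n≡m (1+s∣P s<K)) ⟩
      P * P                         ∎)

  sum[P/1+s]*φ≤P*P : sum< K (λ s → P / suc s) * φ P ≤ P * P
  sum[P/1+s]*φ≤P*P = begin
    sum< K (λ s → P / suc s) * φ P                  ≡⟨ *-comm (sum< K _) (φ P) ⟩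
    φ P * sum< K (λ s → P / suc s)                  ≡⟨ *-distribˡ-sum< (φ P) K _ ⟩
    sum< K (λ s → φ P * (P / suc s))                ≡⟨ sum<-cong K (λ s s<K → trans (*-comm (φ P) _)
                                                                                 (sym (count-coprimeMultiples s<K))) ⟩
    sum< K (λ s → count (coprimeMultiples s) (P * P)) ≡⟨ sym (count-⋃<-disjoint K coprimeMultiples (P * P)
                                                             (λ {_} {_} {n} → coprimeMultiples-disjoint {n = n})) ⟩
    count (⋃< K coprimeMultiples) (P * P)           ≤⟨ count≤ (⋃< K coprimeMultiples) (P * P) ⟩
    P * P                                           ∎
    where open ≤-Reasoning

φ-factorial-bound : ∀ D → D * φ ((2 ^ (2 * D)) !) ≤ (2 ^ (2 * D)) !
φ-factorial-bound D = *-cancelˡ-≤ P (*-cancelˡ-≤ 2 (begin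
  2 * (P * (D * φ P))               ≡⟨ rearrange 2 P D (φ P) ⟩
  2 * D * P * φ P                   ≤⟨ *-monoˡ-≤ (φ P) (harmonic-lower-bound P (2 * D) f exact) ⟩
  2 * sum< K f * φ P                ≡⟨ *-assoc 2 (sum< K f) (φ P) ⟩
  2 * (sum< K f * φ P)              ≤⟨ *-monoʳ-≤ 2 sum[P/1+s]*φ≤P*P ⟩
  2 * (P * P)                       ∎))
  where
  K = 2 ^ (2 * D)
  open Factorial K
  open ≤-Reasoning
  f : ℕ → ℕ
  f s = P / suc s
  exact : ∀ s → s < K → P ≤ suc s * f s
  exact s s<K = ≤-reflexive (sym (m*[n/m]≡n (1+s∣P s<K)))
  rearrange : ∀ a b c d → a * (b * (c * d)) ≡ a * c * b * d
  rearrange = solve-∀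

m<[1+m/n]*n : ∀ m n .{{_ : NonZero n}} → m < suc (m / n) * n
m<[1+m/n]*n m n = begin-strict
  m                  ≡⟨ m≡m%n+[m/n]*n m n ⟩
  m % n + m / n * n  <⟨ +-monoˡ-< (m / n * n) (m%n<n m n) ⟩
  suc (m / n) * n    ∎
  where open ≤-Reasoning

count-coprimeTo-≤ : ∀ {D P} .{{_ : NonZero P}} y → D * φ P ≤ P → D * count (coprimeTo P) y ≤ y + P
count-coprimeTo-≤ {D} {P} y Dφ≤P = begin
  D * count (coprimeTo P) y       ≤⟨ *-monoʳ-≤ D (count-monoʳ (coprimeTo P) (<⇒≤ (m<[1+m/n]*n y P))) ⟩
  D * count (coprimeTo P) (suc q * P) ≡⟨ cong (D *_) (count-coprimeTo P (suc q)) ⟩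
  D * (suc q * φ P)               ≡⟨ x*[y*z]≡y*[x*z] D (suc q) (φ P) ⟩
  suc q * (D * φ P)               ≤⟨ *-monoʳ-≤ (suc q) Dφ≤P ⟩
  P + q * P                       ≤⟨ +-monoʳ-≤ P (m/n*n≤m y P) ⟩
  P + y                           ≡⟨ +-comm P y ⟩
  y + P                           ∎
  where
  open ≤-Reasoning
  q = y / P
  x*[y*z]≡y*[x*z] : ∀ x y z → x * (y * z) ≡ y * (x * z)
  x*[y*z]≡y*[x*z] = solve-∀

count-multiples-coprimeTo-≤ : ∀ {D P} .{{_ : NonZero P}} t .{{_ : NonZero t}} M x → D * φ P ≤ P →
  D * count (⋃< M (λ k → multiples (suc (t + k)) (coprimeTo P))) x ≤ M * (x / t + P)
count-multiples-coprimeTo-≤ {D} {P} t M x Dφ≤P = begin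
  D * count (⋃< M F) x                         ≤⟨ *-monoʳ-≤ D (count-⋃< M F x) ⟩
  D * sum< M (λ k → count (F k) x)             ≡⟨ *-distribˡ-sum< D M _ ⟩
  sum< M (λ k → D * count (F k) x)             ≤⟨ sum<-mono M (λ k _ → term k) ⟩
  sum< M (λ _ → x / t + P)                     ≡⟨ sum<-const M _ ⟩
  M * (x / t + P)                              ∎
  where
  open ≤-Reasoning
  F : ℕ → NatSet
  F k = multiples (suc (t + k)) (coprimeTo P)
  term : ∀ k → D * count (F k) x ≤ x / t + P
  term k = ≤-trans (*-monoʳ-≤ D (count-multiples-≤ (suc (t + k)) (coprimeTo P) (x / t) x x<))
                   (count-coprimeTo-≤ {D} (x / t) Dφ≤P)
    where
    x< : x < suc (x / t) * suc (t + k)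
    x< = <-≤-trans (m<[1+m/n]*n x t) (*-monoʳ-≤ (suc (x / t)) (≤-trans (m≤m+n t k) (n≤1+n _)))

-- Sets without L-multiples

-- The bounds make this decidable and are vacuous for b, d ≥ 1.
PrimesAbove : ℕ → ℕ → Set
PrimesAbove d b = ∀ {p} → p < suc b → Prime p → p ∣ b → ∀ {q} → q < suc d → Prime q → q ∣ d → q ≤ p

primesAbove? : ∀ d b → Dec (PrimesAbove d b)
primesAbove? d b = allUpTo? (λ p → prime? p →-dec p ∣? b →-dec
                     allUpTo? (λ q → prime? q →-dec q ∣? d →-dec q ≤? p) (suc d)) (suc b)

LMultiple : ℕ → ℕ → Set
LMultiple d n = ∃ λ b → b < suc n × n ≡ b * d × PrimesAbove d b

lMultiple? : ∀ d n → Dec (LMultiple d n)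
lMultiple? d n = anyUpTo? (λ b → n ≟ b * d ×-dec primesAbove? d b) (suc n)

InL⇒LMultiple : ∀ {a a'} → 2 ≤ a → InL a a' → LMultiple a a'
InL⇒LMultiple {a} {a'} 2≤a (b , 1≤b , a'≡b*a , b-above) = b , s≤s b≤a' , a'≡b*a , above
  where
  b≤a' : b ≤ a'
  b≤a' = subst (b ≤_) (sym a'≡b*a) (m≤m*n b a {{>-nonZero (<-trans z<s 2≤a)}})
  above : PrimesAbove a b
  above _ p-prime p∣b _ q-prime q∣a with largestPrimeFactor a 2≤a
  ... | P , P-largest@(_ , _ , ≤P) = ≤-trans (≤P _ q-prime q∣a) (b-above _ p-prime p∣b P P-largest)

withoutLMultiples : NatSet → NatSet
withoutLMultiples B n = B n ∧ not ⌊ anyUpTo? (λ d → T? (B d) ×-dec lMultiple? d n) n ⌋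

∉LMultiple : ∀ B {n d} → T (withoutLMultiples B n) → d < n → T (B d) → ¬ LMultiple d n
∉LMultiple B {n} {d} n∈A d<n d∈B n∈Ld with anyUpTo? (λ d → T? (B d) ×-dec lMultiple? d n) n
... | yes _   = Equivalence.to T-∧ n∈A .proj₂
... | no none = none (d , d<n , d∈B , n∈Ld)

∉withoutLMultiples : ∀ B {n} → T (B n) → ¬ T (withoutLMultiples B n) → ∃ λ d → d < n × T (B d) × LMultiple d n
∉withoutLMultiples B {n} n∈B n∉A with anyUpTo? (λ d → T? (B d) ×-dec lMultiple? d n) n
... | yes found = found
... | no _      = ⊥-elim (n∉A (Equivalence.from T-∧ (n∈B , tt)))

withoutLMultiples-LPrimitive : ∀ B → SubsetGt1 B → LPrimitive (withoutLMultiples B)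
withoutLMultiples-LPrimitive B B>1 = A>1 , no-LMultiples
  where
  A>1 : SubsetGt1 (withoutLMultiples B)
  A>1 n n∈A = B>1 n (Equivalence.to T-∧ n∈A .proj₁)

  no-LMultiples : ∀ a a' → T (withoutLMultiples B a) → T (withoutLMultiples B a') → a ≢ a' → ¬ InL a a'
  no-LMultiples a a' a∈A a'∈A a≢a' a'∈La@(b , 1≤b , a'≡b*a , _) =
    ∉LMultiple B a'∈A a<a' a∈B (InL⇒LMultiple 2≤a a'∈La)
    where
    a∈B = Equivalence.to T-∧ a∈A .proj₁
    2≤a = B>1 a a∈B
    2≤b : 2 ≤ b
    2≤b with m≤n⇒m<n∨m≡n 1≤b
    ... | inj₁ 1<b = 1<b
    ... | inj₂ refl = ⊥-elim (a≢a' (sym (trans a'≡b*a (*-identityˡ a))))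
    a<a' : a < a'
    a<a' = subst (a <_) (trans (*-comm a b) (sym a'≡b*a)) (m<m*n a b {{>-nonZero (<-trans z<s 2≤a)}} 2≤b)

-- The construction

n<2^n : ∀ n → n < 2 ^ n
n<2^n zero    = z<s
n<2^n (suc n) = begin-strict
  suc n          <⟨ s≤s (n<2^n n) ⟩
  suc (2 ^ n)    ≤⟨ +-monoʳ-≤ 1 (m≤m+n (2 ^ n) 0) ⟩
  1 + (2 ^ n + 0) ≤⟨ +-monoˡ-≤ _ (m^n>0 2 n) ⟩
  2 ^ suc n      ∎
  where open ≤-Reasoning

polynomial≤exponential : ∀ K a B → ∃ λ L → B ≤ L × (L + a) ^ K ≤ 2 ^ L
polynomial≤exponential K a B = t * t , B≤t*t , bound
  where
  t = B + a + 2 * K + 1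
  B≤t*t : B ≤ t * t
  B≤t*t = ≤-trans (≤-trans (m≤m+n B a) (≤-trans (m≤m+n _ (2 * K)) (m≤m+n _ 1)))
                  (m≤m*n t t {{>-nonZero (≤-trans (s≤s z≤n) (≤-reflexive (+-comm 1 _)))}})
  t*t+a≤[1+t]^2 : t * t + a ≤ suc t ^ 2
  t*t+a≤[1+t]^2 = begin
    t * t + a           ≤⟨ +-monoʳ-≤ (t * t) (≤-trans (m≤n+m a B) (≤-trans (m≤m+n _ (2 * K)) (m≤m+n _ 1))) ⟩
    t * t + t           ≤⟨ +-monoʳ-≤ (t * t) (≤-trans (m≤m+n t t) (m≤m+n (t + t) 1)) ⟩
    t * t + (t + t + 1) ≡⟨ square t ⟩
    suc t ^ 2           ∎
    where
    open ≤-Reasoning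
    square : ∀ t → t * t + (t + t + 1) ≡ suc t * (suc t * 1)
    square = solve-∀
  bound : (t * t + a) ^ K ≤ 2 ^ (t * t)
  bound = begin
    (t * t + a) ^ K   ≤⟨ ^-monoˡ-≤ K t*t+a≤[1+t]^2 ⟩
    (suc t ^ 2) ^ K   ≡⟨ ^-*-assoc (suc t) 2 K ⟩
    suc t ^ (2 * K)   ≤⟨ ^-monoʳ-≤ (suc t) (≤-trans (m≤n+m (2 * K) (B + a)) (m≤m+n _ 1)) ⟩
    suc t ^ t         ≤⟨ ^-monoˡ-≤ t (n<2^n t) ⟩
    (2 ^ t) ^ t       ≡⟨ ^-*-assoc 2 t t ⟩
    2 ^ (t * t)       ∎
    where open ≤-Reasoning

a*2^b*c≤2^[b+a+c] : ∀ a b c → a * 2 ^ b * c ≤ 2 ^ (b + a + c)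
a*2^b*c≤2^[b+a+c] a b c = begin
  a * 2 ^ b * c          ≤⟨ *-mono-≤ (*-monoˡ-≤ (2 ^ b) (<⇒≤ (n<2^n a))) (<⇒≤ (n<2^n c)) ⟩
  2 ^ a * 2 ^ b * 2 ^ c  ≡⟨ cong (_* 2 ^ c) (trans (*-comm (2 ^ a) (2 ^ b)) (sym (^-distribˡ-+-* 2 b a))) ⟩
  2 ^ (b + a) * 2 ^ c    ≡⟨ sym (^-distribˡ-+-* 2 (b + a) c) ⟩
  2 ^ (b + a + c)        ∎
  where open ≤-Reasoning

module Parameters (m : ℕ) .{{_ : NonZero m}} where

  C : ℕ
  C = 4 * m

  D : ℕ → ℕ
  D i = (C + 1) * (8 * m * 2 ^ suc i)

  K : ℕ → ℕ
  K i = 2 ^ (2 * D i)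

  P : ℕ → ℕ
  P i = K i !

  private
    choose : ℕ → ℕ → ℕ
    choose j B = proj₁ (polynomial≤exponential (K j) (suc C) B)

    choose-≥ : ∀ j B → B ≤ choose j B
    choose-≥ j B = proj₁ (proj₂ (polynomial≤exponential (K j) (suc C) B))

    choose-pow : ∀ j B → (choose j B + suc C) ^ K j ≤ 2 ^ choose j B
    choose-pow j B = proj₂ (proj₂ (polynomial≤exponential (K j) (suc C) B))

  -- L is chosen so that at most lower j integers up to upper j are K j-smooth (L-pow),
  -- and so that block j + 1 starts beyond C · lower j · P j (L-step).
  L : ℕ → ℕ
  L zero    = choose 0 0
  L (suc j) = choose (suc j) (L j + C + P j)

  lower : ℕ → ℕ
  lower j = 2 ^ L j

  upper : ℕ → ℕ
  upper j = C * lower j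

  instance
    C≢0 : NonZero C
    C≢0 = m*n≢0 4 m

  L-step : ∀ j → L j + C + P j ≤ L (suc j)
  L-step j = choose-≥ (suc j) (L j + C + P j)

  L-pow : ∀ j → (L j + suc C) ^ K j ≤ lower j
  L-pow zero    = choose-pow 0 0
  L-pow (suc j) = choose-pow (suc j) (L j + C + P j)

  L<L[1+] : ∀ j → L j < L (suc j)
  L<L[1+] j = <-≤-trans (m<m+n (L j) (>-nonZero⁻¹ (P j) {{K j !≢0}}))
                        (≤-trans (+-monoˡ-≤ (P j) (m≤m+n (L j) C)) (L-step j))

  L-mono : ∀ {i j} → i ≤ j → L i ≤ L j
  L-mono {j = zero}  z≤n = ≤-refl
  L-mono {j = suc j} i≤1+j with m≤n⇒m<n∨m≡n i≤1+j
  ... | inj₁ i<1+j = ≤-trans (L-mono (m<1+n⇒m≤n i<1+j)) (<⇒≤ (L<L[1+] j))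
  ... | inj₂ refl  = ≤-refl

  j≤L : ∀ j → j ≤ L j
  j≤L zero    = z≤n
  j≤L (suc j) = ≤-trans (s≤s (j≤L j)) (L<L[1+] j)

  L<lower : ∀ j → L j < lower j
  L<lower j = n<2^n (L j)

  lower≤upper : ∀ j → lower j ≤ upper j
  lower≤upper j = m≤n*m (lower j) C

  lower-mono : ∀ {i j} → i ≤ j → lower i ≤ lower j
  lower-mono i≤j = ^-monoʳ-≤ 2 (L-mono i≤j)

  C*lower*P≤lower : ∀ i → C * lower i * P i ≤ lower (suc i)
  C*lower*P≤lower i = ≤-trans (a*2^b*c≤2^[b+a+c] C (L i) (P i)) (^-monoʳ-≤ 2 (L-step i))

  upper≤lower : ∀ {i j} → i < j → upper i ≤ lower j
  upper≤lower {i} i<j = ≤-trans (m≤m*n (upper i) (P i) {{K i !≢0}}) (≤-trans (C*lower*P≤lower i) (lower-mono i<j))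

  C*lower*P≤upper : ∀ {i j} → i < j → C * lower i * P i ≤ upper j
  C*lower*P≤upper {i} {j} i<j = ≤-trans (C*lower*P≤lower i) (≤-trans (lower-mono i<j) (lower≤upper j))

  lower≢0 : ∀ i → NonZero (lower i)
  lower≢0 i = m^n≢0 2 (L i)

  C<K : ∀ i → C < K i
  C<K i = begin-strict
    C          <⟨ n<1+n C ⟩
    suc C      ≤⟨ ≤-trans (≤-reflexive (+-comm 1 C)) (m≤m*n (C + 1) (8 * m * 2 ^ suc i) {{nz}}) ⟩
    D i        ≤⟨ m≤n*m (D i) 2 ⟩
    2 * D i    <⟨ n<2^n (2 * D i) ⟩
    K i        ∎
    where
    open ≤-Reasoning
    nz : NonZero (8 * m * 2 ^ suc i)
    nz = m*n≢0 (8 * m) (2 ^ suc i) {{m*n≢0 8 m}} {{m^n≢0 2 (suc i)}}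

  upper≤2^[L+C] : ∀ j → upper j ≤ 2 ^ (L j + C)
  upper≤2^[L+C] j = begin
    C * 2 ^ L j        ≤⟨ *-monoˡ-≤ (2 ^ L j) (<⇒≤ (n<2^n C)) ⟩
    2 ^ C * 2 ^ L j    ≡⟨ sym (^-distribˡ-+-* 2 C (L j)) ⟩
    2 ^ (C + L j)      ≡⟨ cong (2 ^_) (+-comm C (L j)) ⟩
    2 ^ (L j + C)      ∎
    where open ≤-Reasoning

module Construction (m : ℕ) .{{_ : NonZero m}} where

  open Parameters m

  InBlock : ℕ → ℕ → Set
  InBlock i n = lower i < n × n ≤ upper i × HasPrimeFactorAbove (K i) n

  inBlock? : ∀ i n → Dec (InBlock i n)
  inBlock? i n = lower i <? n ×-dec n ≤? upper i ×-dec hasPrimeFactorAbove? (K i) n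

  -- A block containing n has index i ≤ L i < lower i < n.
  blocks : NatSet
  blocks n = ⌊ anyUpTo? (λ i → inBlock? i n) (suc n) ⌋

  InBlock⇒∈blocks : ∀ {i n} → InBlock i n → T (blocks n)
  InBlock⇒∈blocks {i} n∈Bi@(lower<n , _) =
    fromWitness (i , s≤s (≤-trans (j≤L i) (≤-trans (<⇒≤ (L<lower i)) (<⇒≤ lower<n))) , n∈Bi)

  ∈blocks⇒InBlock : ∀ {n} → T (blocks n) → ∃ λ i → InBlock i n
  ∈blocks⇒InBlock n∈B with toWitness n∈B
  ... | i , _ , n∈Bi = i , n∈Bi

  blocks>1 : SubsetGt1 blocks
  blocks>1 n n∈B with ∈blocks⇒InBlock n∈B
  ... | i , lower<n , _ = ≤-trans (s≤s (m^n>0 2 (L i))) lower<n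

  A : NatSet
  A = withoutLMultiples blocks

  A-LPrimitive : LPrimitive A
  A-LPrimitive = withoutLMultiples-LPrimitive blocks blocks>1

  -- The multiples b · d, b coprime to P i, of all d in (lower i, lower i + upper i] ⊇ block i.
  bad : ℕ → NatSet
  bad i = ⋃< (upper i) (λ k → multiples (suc (lower i + k)) (coprimeTo (P i)))

  count-bad : ∀ i x → 8 * m * 2 ^ suc i * count (bad i) x ≤ x + C * lower i * P i
  count-bad i x = *-cancelˡ-≤ (C + 1) {{C+1≢0}} (begin
    (C + 1) * (8 * m * 2 ^ suc i * count (bad i) x)  ≡⟨ sym (*-assoc (C + 1) _ _) ⟩
    D i * count (bad i) x                            ≤⟨ count-multiples-coprimeTo-≤ {D i} (lower i) (upper i) x
                                                          (φ-factorial-bound (D i)) ⟩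
    upper i * (x / lower i + P i)                    ≡⟨ *-distribˡ-+ (upper i) _ (P i) ⟩
    C * lower i * (x / lower i) + C * lower i * P i  ≤⟨ +-monoˡ-≤ _ (≤-trans (≤-reflexive (*-assoc C (lower i) _))
                                                          (*-monoʳ-≤ C (≤-trans (≤-reflexive (*-comm (lower i) _)) (m/n*n≤m x (lower i))))) ⟩
    C * x + C * lower i * P i                        ≤⟨ +-mono-≤ (*-monoˡ-≤ x (m≤m+n C 1)) (m≤n*m _ (C + 1) {{C+1≢0}}) ⟩
    (C + 1) * x + (C + 1) * (C * lower i * P i)      ≡⟨ sym (*-distribˡ-+ (C + 1) x _) ⟩
    (C + 1) * (x + C * lower i * P i)                ∎)
    where
    open ≤-Reasoning
    C+1≢0 : NonZero (C + 1)
    C+1≢0 = >-nonZero (≤-trans (s≤s z≤n) (≤-reflexive (+-comm 1 C)))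
    instance
      _ = lower≢0 i
      _ = K i !≢0

  count-bad-earlier : ∀ j → 4 * m * sum< j (λ i → count (bad i) (upper j)) ≤ upper j
  count-bad-earlier j = *-cancelˡ-≤ 2 (begin
    2 * (4 * m * sum< j c)          ≡⟨ double m (sum< j c) ⟩
    8 * m * sum< j c                ≡⟨ *-distribˡ-sum< (8 * m) j c ⟩
    sum< j (λ i → 8 * m * c i)      ≤⟨ sum<-halving j _ (2 * upper j) weighted ⟩
    2 * upper j                     ∎)
    where
    open ≤-Reasoning
    c : ℕ → ℕ
    c i = count (bad i) (upper j)
    weighted : ∀ i → i < j → 2 ^ suc i * (8 * m * c i) ≤ 2 * upper j
    weighted i i<j = begin
      2 ^ suc i * (8 * m * c i)           ≡⟨ swap (2 ^ suc i) (8 * m) (c i) ⟩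
      8 * m * 2 ^ suc i * c i             ≤⟨ count-bad i (upper j) ⟩
      upper j + C * lower i * P i         ≤⟨ +-monoʳ-≤ (upper j) (C*lower*P≤upper i<j) ⟩
      upper j + upper j                   ≡⟨ cong (upper j +_) (sym (+-identityʳ (upper j))) ⟩
      2 * upper j                         ∎
      where
      swap : ∀ a b c → a * (b * c) ≡ b * a * c
      swap = solve-∀
    double : ∀ m s → 2 * (4 * m * s) ≡ 8 * m * s
    double = solve-∀

  later-block-impossible : ∀ {i j d n} → j < i → InBlock i d → d < n → n ≤ upper j → ⊥
  later-block-impossible j<i (lower<d , _) d<n n≤upper =
    <⇒≱ (<-trans lower<d d<n) (≤-trans n≤upper (upper≤lower j<i))

  same-block-impossible : ∀ {j d n} → InBlock j d → LMultiple d n → d < n → n ≤ upper j → ⊥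
  same-block-impossible {j} {d} _ (zero , _ , refl , _) d<0 _ = n≮0 d<0
  same-block-impossible {j} {d} _ (suc zero , _ , refl , _) d<d+0 _ = <-irrefl (sym (+-identityʳ d)) d<d+0
  same-block-impossible {j} {d} (lower<d , _ , q , q<1+d , q-prime , q∣d , K<q)
                                (b@(suc (suc _)) , _ , refl , above) _ n≤upper
    with primeFactor b (s≤s (s≤s z≤n))
  ... | p , p-prime , p∣b = <⇒≱ upper<b*d n≤upper
    where
    open ≤-Reasoning
    q≤p : q ≤ p
    q≤p = above (s≤s (∣⇒≤ p∣b)) p-prime p∣b q<1+d q-prime q∣d
    upper<b*d : upper j < b * d
    upper<b*d = begin-strict
      C * lower j    ≤⟨ *-monoˡ-≤ (lower j) (<⇒≤ (C<K j)) ⟩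
      K j * lower j  <⟨ *-mono-< K<q lower<d ⟩
      q * d          ≤⟨ *-monoˡ-≤ d (≤-trans q≤p (∣⇒≤ p∣b)) ⟩
      b * d          ∎

  earlier-block⇒bad : ∀ {i d n} → InBlock i d → LMultiple d n → 1 ≤ n → T (bad i n)
  earlier-block⇒bad {i} {suc e} (lower<d , d≤upper , q , q<1+d , q-prime , q∣d , K<q)
                                (b , _ , refl , above) 1≤n =
    ∈-⋃< (upper i) _ k<upper n∈multiples
    where
    k = e ∸ lower i
    lower+k≡e : lower i + k ≡ e
    lower+k≡e = m+[n∸m]≡n (≤-pred lower<d)
    k<upper : k < upper i
    k<upper = ≤-<-trans (m∸n≤m e (lower i)) d≤upper
    1≤b : 1 ≤ b
    1≤b = >-nonZero⁻¹ b {{m*n≢0⇒m≢0 b {{>-nonZero 1≤n}}}}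
    b-coprime : Coprime b (P i)
    b-coprime = coprime-factorial b (K i) (λ p p-prime p∣b →
      <-≤-trans K<q (above (s≤s (∣⇒≤ {{>-nonZero 1≤b}} p∣b)) p-prime p∣b q<1+d q-prime q∣d))
    n∈multiples : T (multiples (suc (lower i + k)) (coprimeTo (P i)) (b * suc e))
    n∈multiples = subst (λ y → T (multiples (suc (lower i + k)) (coprimeTo (P i)) (b * suc y))) lower+k≡e
                    (∈-multiples (suc (lower i + k)) (coprimeTo (P i)) {b} (fromWitness (λ {d} → b-coprime {d})))

  removed⇒bad : ∀ j n → 1 ≤ n → n ≤ upper j → T (blocks n) → ¬ T (A n) → T (⋃< j bad n)
  removed⇒bad j n 1≤n n≤upper n∈blocks n∉A with ∉withoutLMultiples blocks n∈blocks n∉A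
  ... | d , d<n , d∈blocks , n∈Ld with ∈blocks⇒InBlock d∈blocks
  ...   | i , d∈Bi with <-cmp i j
  ...     | tri< i<j _ _  = ∈-⋃< j bad i<j (earlier-block⇒bad {i} {d} {n} d∈Bi n∈Ld 1≤n)
  ...     | tri≈ _ refl _ = ⊥-elim (same-block-impossible {j} {d} {n} d∈Bi n∈Ld d<n n≤upper)
  ...     | tri> _ _ j<i  = ⊥-elim (later-block-impossible {i} {j} {d} {n} j<i d∈Bi d<n n≤upper)

  ∁A⊆ : ∀ j n → 1 ≤ n → n ≤ upper j → T (∁ A n) → T ((atMost (lower j) ∪ (smooth (K j) ∪ ⋃< j bad)) n)
  ∁A⊆ j n 1≤n n≤upper n∈∁A with n ≤? lower j | T? (smooth (K j) n)
  ... | yes _ | _ = tt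
  ... | no _  | yes n∈smooth = Equivalence.from T-∨ (inj₁ n∈smooth)
  ... | no n≰lower | no n∉smooth =
    Equivalence.from T-∨ (inj₂ (removed⇒bad j n 1≤n n≤upper n∈blocks (∁-∉ {A} {n} n∈∁A)))
    where
    n∈blocks : T (blocks n)
    n∈blocks = InBlock⇒∈blocks {j} {n} (≰⇒> n≰lower , n≤upper , ¬smooth⇒HasPrimeFactorAbove n∉smooth)

  count-smooth-upper : ∀ j → count (smooth (K j)) (upper j) ≤ lower j
  count-smooth-upper j = begin
    count (smooth (K j)) (upper j) ≤⟨ count-smooth (K j) (L j + C) (upper j) (upper≤2^[L+C] j) ⟩
    suc (L j + C) ^ K j            ≡⟨ cong (_^ K j) (sym (+-suc (L j) C)) ⟩
    (L j + suc C) ^ K j            ≤⟨ L-pow j ⟩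
    lower j                        ∎
    where open ≤-Reasoning

  count-∁A : ∀ j → count (∁ A) (upper j) ≤ lower j + (lower j + sum< j (λ i → count (bad i) (upper j)))
  count-∁A j = begin
    count (∁ A) U                                     ≤⟨ count-mono U (∁A⊆ j) ⟩
    count (atMost (lower j) ∪ (smooth (K j) ∪ ⋃< j bad)) U
                                                      ≤⟨ count-∪ (atMost (lower j)) _ U ⟩
    count (atMost (lower j)) U + count (smooth (K j) ∪ ⋃< j bad) U
                                                      ≤⟨ +-mono-≤ (count-atMost (lower j) U) (count-∪ (smooth (K j)) (⋃< j bad) U) ⟩
    lower j + (count (smooth (K j)) U + count (⋃< j bad) U)
                                                      ≤⟨ +-monoʳ-≤ (lower j) (+-mono-≤ (count-smooth-upper j) (count-⋃< j bad U)) ⟩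
    lower j + (lower j + sum< j (λ i → count (bad i) U)) ∎
    where
    open ≤-Reasoning
    U = upper j

  ∁A-sparse : ∀ j → m * count (∁ A) (upper j) ≤ upper j
  ∁A-sparse j = *-cancelˡ-≤ 4 (begin
    4 * (m * count (∁ A) U)                ≤⟨ *-monoʳ-≤ 4 (*-monoʳ-≤ m (count-∁A j)) ⟩
    4 * (m * (lower j + (lower j + S)))    ≡⟨ expand m (lower j) S ⟩
    4 * m * lower j + (4 * m * lower j + 4 * m * S)
                                           ≤⟨ +-monoʳ-≤ U (+-monoʳ-≤ U (count-bad-earlier j)) ⟩
    U + (U + U)                            ≤⟨ m≤m+n _ U ⟩
    U + (U + U) + U                        ≡⟨ collect U ⟩
    4 * U                                  ∎)
    where
    open ≤-Reasoning
    U = upper j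
    S = sum< j (λ i → count (bad i) U)
    expand : ∀ m t s → 4 * (m * (t + (t + s))) ≡ 4 * m * t + (4 * m * t + 4 * m * s)
    expand = solve-∀
    collect : ∀ u → u + (u + u) + u ≡ 4 * u
    collect = solve-∀

  A-dense : ∀ N → ∃ λ x → N ≤ x × m * x ≤ m * count A x + x
  A-dense N = upper N , N≤upper , (begin
    m * U                              ≡⟨ cong (m *_) (sym (count-∁ A U)) ⟩
    m * (count A U + count (∁ A) U)    ≡⟨ *-distribˡ-+ m _ _ ⟩
    m * count A U + m * count (∁ A) U  ≤⟨ +-monoʳ-≤ (m * count A U) (∁A-sparse N) ⟩
    m * count A U + U                  ∎)
    where
    open ≤-Reasoning
    U = upper N
    N≤upper : N ≤ U
    N≤upper = ≤-trans (j≤L N) (≤-trans (<⇒≤ (L<lower N)) (lower≤upper N))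

-- Passing to rational densities

fromℕ≡mkℚ : ∀ a → fromℕ a ≡ ℚ.mkℚ (ℤ.+ a) 0 (Coprimality.sym (Coprimality.1-coprimeTo a))
fromℕ≡mkℚ a = ℚ.normalize-coprime _

fromℕ-mono-≤ : ∀ {a b} → a ≤ b → fromℕ a ℚ.≤ fromℕ b
fromℕ-mono-≤ {a} {b} a≤b rewrite fromℕ≡mkℚ a | fromℕ≡mkℚ b =
  ℚ.*≤* (subst₂ ℤ._≤_ (sym (ℤ.*-identityʳ (ℤ.+ a))) (sym (ℤ.*-identityʳ (ℤ.+ b))) (ℤ.+≤+ a≤b))

fromℕ-+ : ∀ a b → fromℕ (a + b) ≡ fromℕ a ℚ.+ fromℕ b
fromℕ-+ a b rewrite fromℕ≡mkℚ a | fromℕ≡mkℚ b =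
  cong (ℚ._/ 1) (trans (ℤ.pos-+ a b) (sym (cong₂ ℤ._+_ (ℤ.*-identityʳ (ℤ.+ a)) (ℤ.*-identityʳ (ℤ.+ b)))))

fromℕ-* : ∀ a b → fromℕ (a * b) ≡ fromℕ a ℚ.* fromℕ b
fromℕ-* a b rewrite fromℕ≡mkℚ a | fromℕ≡mkℚ b = cong (ℚ._/ 1) (ℤ.pos-* a b)

fromℕ-nonNeg : ∀ a → ℚ.NonNegative (fromℕ a)
fromℕ-nonNeg a = ℚ.nonNegative (fromℕ-mono-≤ {0} {a} z≤n)

fromℕ-pos : ∀ n .{{_ : NonZero n}} → ℚ.Positive (fromℕ n)
fromℕ-pos n@(suc _) = subst ℚ.Positive (sym (fromℕ≡mkℚ n)) _

1≤ε*↧ε : ∀ ε → ℚ.0ℚ ℚ.< ε → ℚ.1ℚ ℚ.≤ ε ℚ.* fromℕ (ℚ.↧ₙ ε)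
1≤ε*↧ε ε 0<ε = positive-case ε (ℚ.positive 0<ε)
  where
  positive-case : ∀ ε → ℚ.Positive ε → ℚ.1ℚ ℚ.≤ ε ℚ.* fromℕ (ℚ.↧ₙ ε)
  positive-case ε@(ℚ.mkℚ ℤ.+[1+ k ] d-1 _) _ =
    ℚ.toℚᵘ-cancel-≤ (ℚᵘ.≤-respʳ-≃ (ℚᵘ.≃-sym (ℚ.toℚᵘ-homo-* ε (fromℕ (suc d-1)))) 1≤ε*d)
    where
    1≤ε*d : ℚ.toℚᵘ ℚ.1ℚ ℚᵘ.≤ ℚ.toℚᵘ ε ℚᵘ.* ℚ.toℚᵘ (fromℕ (suc d-1))
    1≤ε*d rewrite fromℕ≡mkℚ (suc d-1) =
      ℚᵘ.*≤* (subst₂ ℤ._≤_ (sym (ℤ.*-identityˡ _)) (trans (ℤ.pos-* (suc k) (suc d-1)) (sym (ℤ.*-identityʳ _)))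
               (ℤ.+≤+ (≤-trans (≤-reflexive (cong suc (*-identityʳ d-1))) (m≤n*m (suc d-1) (suc k)))))

open +-*-Solver

count≤[1+δ]x : ∀ c x δ → ℚ.0ℚ ℚ.< δ → c ≤ x → fromℕ c ℚ.≤ (ℚ.1ℚ ℚ.+ δ) ℚ.* fromℕ x
count≤[1+δ]x c x δ 0<δ c≤x = begin
  fromℕ c                       ≤⟨ fromℕ-mono-≤ c≤x ⟩
  fromℕ x                       ≡⟨ sym (ℚ.*-identityˡ (fromℕ x)) ⟩
  ℚ.1ℚ ℚ.* fromℕ x              ≤⟨ ℚ.*-monoʳ-≤-nonNeg (fromℕ x) {{fromℕ-nonNeg x}} 1≤1+δ ⟩
  (ℚ.1ℚ ℚ.+ δ) ℚ.* fromℕ x      ∎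
  where
  open ℚ.≤-Reasoning
  1≤1+δ : ℚ.1ℚ ℚ.≤ ℚ.1ℚ ℚ.+ δ
  1≤1+δ = subst (ℚ._≤ ℚ.1ℚ ℚ.+ δ) (ℚ.+-identityʳ ℚ.1ℚ) (ℚ.+-monoʳ-≤ ℚ.1ℚ (ℚ.<⇒≤ 0<δ))

[1-ε-δ]x≤count : ∀ ε δ c x → ℚ.0ℚ ℚ.< ε → ℚ.0ℚ ℚ.< δ → ℚ.↧ₙ ε * x ≤ ℚ.↧ₙ ε * c + x →
                 (ℚ.1ℚ ℚ.- ε ℚ.- δ) ℚ.* fromℕ x ℚ.≤ fromℕ c
[1-ε-δ]x≤count ε δ c x 0<ε 0<δ dx≤dc+x = begin
  (ℚ.1ℚ ℚ.- ε ℚ.- δ) ℚ.* X    ≤⟨ ℚ.*-monoʳ-≤-nonNeg X {{fromℕ-nonNeg x}} drop-δ ⟩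
  (ℚ.1ℚ ℚ.- ε) ℚ.* X          ≤⟨ ℚ.*-cancelʳ-≤-pos Dq {{fromℕ-pos d}} scaled ⟩
  fromℕ c                     ∎
  where
  open ℚ.≤-Reasoning
  d = ℚ.↧ₙ ε
  X = fromℕ x
  Dq = fromℕ d
  drop-δ : ℚ.1ℚ ℚ.- ε ℚ.- δ ℚ.≤ ℚ.1ℚ ℚ.- ε
  drop-δ = subst (ℚ.1ℚ ℚ.- ε ℚ.- δ ℚ.≤_) (ℚ.+-identityʳ (ℚ.1ℚ ℚ.- ε))
                 (ℚ.+-monoʳ-≤ (ℚ.1ℚ ℚ.- ε) (ℚ.neg-antimono-≤ (ℚ.<⇒≤ 0<δ)))
  Dx≤Dc+x : X ℚ.* Dq ℚ.≤ fromℕ c ℚ.* Dq ℚ.+ X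
  Dx≤Dc+x = subst₂ ℚ._≤_ (fromℕ-* x d) (trans (fromℕ-+ (c * d) x) (cong (ℚ._+ X) (fromℕ-* c d)))
              (fromℕ-mono-≤ (subst₂ _≤_ (*-comm d x) (cong (_+ x) (*-comm d c)) dx≤dc+x))
  x≤εdx : ℚ.1ℚ ℚ.* X ℚ.≤ (ε ℚ.* Dq) ℚ.* X
  x≤εdx = ℚ.*-monoʳ-≤-nonNeg X {{fromℕ-nonNeg x}} (1≤ε*↧ε ε 0<ε)
  scaled : (ℚ.1ℚ ℚ.- ε) ℚ.* X ℚ.* Dq ℚ.≤ fromℕ c ℚ.* Dq
  scaled = begin
    (ℚ.1ℚ ℚ.- ε) ℚ.* X ℚ.* Dq                      ≡⟨ expand ε X Dq ⟩
    X ℚ.* Dq ℚ.+ ℚ.- ((ε ℚ.* Dq) ℚ.* X)            ≤⟨ ℚ.+-monoʳ-≤ (X ℚ.* Dq) (ℚ.neg-antimono-≤ x≤εdx) ⟩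
    X ℚ.* Dq ℚ.+ ℚ.- (ℚ.1ℚ ℚ.* X)                  ≤⟨ ℚ.+-monoˡ-≤ (ℚ.- (ℚ.1ℚ ℚ.* X)) Dx≤Dc+x ⟩
    fromℕ c ℚ.* Dq ℚ.+ X ℚ.+ ℚ.- (ℚ.1ℚ ℚ.* X)      ≡⟨ cancel (fromℕ c) Dq X ⟩
    fromℕ c ℚ.* Dq                                 ∎
    where
    expand : ∀ a b c → (ℚ.1ℚ ℚ.- a) ℚ.* b ℚ.* c ≡ b ℚ.* c ℚ.+ ℚ.- ((a ℚ.* c) ℚ.* b)
    expand = solve 3 (λ a b c → (con ℚ.1ℚ :- a) :* b :* c := b :* c :+ :- ((a :* c) :* b)) refl
    cancel : ∀ a b c → a ℚ.* b ℚ.+ c ℚ.+ ℚ.- (ℚ.1ℚ ℚ.* c) ≡ a ℚ.* b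
    cancel = solve 3 (λ a b c → a :* b :+ c :+ :- (con ℚ.1ℚ :* c) := a :* b) refl

UpperDensityLE-1 : ∀ A → UpperDensityLE A ℚ.1ℚ
UpperDensityLE-1 A δ 0<δ = 0 , λ x _ → count≤[1+δ]x (count A x) x δ 0<δ (count≤ A x)

UpperDensityGE-1-ε : ∀ A ε → ℚ.0ℚ ℚ.< ε →
                     (∀ N → ∃ λ x → N ≤ x × ℚ.↧ₙ ε * x ≤ ℚ.↧ₙ ε * count A x + x) →
                     UpperDensityGE A (ℚ.1ℚ ℚ.- ε)
UpperDensityGE-1-ε A ε 0<ε dense δ 0<δ N with dense N
... | x , N≤x , dx≤dc+x = x , N≤x , [1-ε-δ]x≤count ε δ (count A x) x 0<ε 0<δ dx≤dc+x

proposition5p2 : SupLPrimitiveUpperDensityIsOne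
proposition5p2 = (λ A _ → UpperDensityLE-1 A) , λ ε 0<ε →
  let open Construction (ℚ.↧ₙ ε) in A , A-LPrimitive , UpperDensityGE-1-ε A ε 0<ε A-dense
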